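{- Let $k\ge 0$, $r\ge 1$ and $n\ge 0$ be integers and $\nu=\lfloor n/2\rfloor$. The number $m_{k,r}^{(n)}$ of $k$-Motzkin paths of length $n$ whose horizontal steps are each colored with one of $r$ colors is $$m_{k,r}^{(n)}=\sum_{j=0}^{\nu}\sum_{i=0}^{\infty}p^{2j}_{k,i}\binom{n-2j+i-1}{n-2j}r^{n-2j},$$ where $p^{2j}_{k,i}$ is the number of Dyck paths of length $2j$ that are $i$-ped at level $k$, and $\binom{ -1}{0}$ is taken to be $1$.
   Context: A Motzkin path of length $n$ is a lattice path with $n$ steps from $(0,0)$ to $(n,0)$ using steps $(1,1)$, $(1,0)$, $(1,-1)$ that never goes below the $x$-axis. A Dyck path is a Motzkin path with no $(1,0)$ steps. A $k$-Motzkin path is a Motzkin path all of whose horizontal steps lie at height $k$. A Dyck path of length $2j$ has $2j+1$ vertices; it is $i$-ped at level $k$ if exactly $i$ of its vertices have $y$-coordinate $k$. For $a\ge0$, $\binom{a+i-1}{a}$ equals $0$ if $i=0$, $a>0$. -}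

module Defs where

open import Data.Nat using (ℕ; zero; suc; _+_; _*_; _∸_; _^_; _≡ᵇ_)
open import Data.Nat.Combinatorics using (_C_)
open import Data.Fin using (Fin)
open import Data.List using (List; []; _∷_; map; concatMap; upTo)
open import Data.Nat.ListAction using (sum)
open import Data.List.Base using (allFin)
open import Data.Bool using (Bool; true; false; if_then_else_; _∧_)

words : {A : Set} → List A → ℕ → List (List A)
words letters zero    = [] ∷ []
words letters (suc n) = concatMap (λ w → map (_∷ w) letters) (words letters n)

count : {A : Set} → (A → Bool) → List A → ℕ
count p xs = sum (map (λ x → if p x then 1 else 0) xs)

sumUpTo : ℕ → (ℕ → ℕ) → ℕ
sumUpTo m f = sum (map f (upTo (suc m)))

data CStep (r : ℕ) : Set where
  up   : CStep r
  down : CStep r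
  flat : Fin r → CStep r

cSteps : (r : ℕ) → List (CStep r)
cSteps r = up ∷ down ∷ map flat (allFin r)

isKMotzkinFrom : {r : ℕ} → ℕ → ℕ → List (CStep r) → Bool
isKMotzkinFrom k h       []           = h ≡ᵇ 0
isKMotzkinFrom k h       (up ∷ w)     = isKMotzkinFrom k (suc h) w
isKMotzkinFrom k zero    (down ∷ w)   = false
isKMotzkinFrom k (suc h) (down ∷ w)   = isKMotzkinFrom k h w
isKMotzkinFrom k h       (flat c ∷ w) = (h ≡ᵇ k) ∧ isKMotzkinFrom k h w

isKMotzkin : {r : ℕ} → ℕ → List (CStep r) → Bool
isKMotzkin k = isKMotzkinFrom k 0

motzkinCount : (k r n : ℕ) → ℕ
motzkinCount k r n = count (isKMotzkin k) (words (cSteps r) n)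

data DStep : Set where
  U D : DStep

dSteps : List DStep
dSteps = U ∷ D ∷ []

isDyckFrom : ℕ → List DStep → Bool
isDyckFrom h       []      = h ≡ᵇ 0
isDyckFrom h       (U ∷ w) = isDyckFrom (suc h) w
isDyckFrom zero    (D ∷ w) = false
isDyckFrom (suc h) (D ∷ w) = isDyckFrom h w

isDyck : List DStep → Bool
isDyck = isDyckFrom 0

-- number of vertices at height k of the path w started at height h
-- (all vertices, including the initial one)
verticesAtFrom : ℕ → ℕ → List DStep → ℕ
verticesAtFrom k h w = (if h ≡ᵇ k then 1 else 0) + rest w
  where
  rest : List DStep → ℕ
  rest []      = 0
  rest (U ∷ w) = verticesAtFrom k (suc h) w
  rest (D ∷ w) = verticesAtFrom k (h ∸ 1) w

verticesAt : ℕ → List DStep → ℕ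
verticesAt k = verticesAtFrom k 0

pedCount : (j k i : ℕ) → ℕ
pedCount j k i =
  count (λ w → isDyck w ∧ (verticesAt k w ≡ᵇ i)) (words dSteps (2 * j))

-- binom(a+i-1, a) with the paper's conventions:
-- binom(-1,0) = 1, and = 0 if i = 0, a > 0.
multiBinom : ℕ → ℕ → ℕ
multiBinom zero    zero    = 1
multiBinom (suc a) zero    = 0
multiBinom a       (suc i) = (a + i) C a

-- Right-hand side. The sum over i ≥ 0 is finite: a Dyck path of length
-- 2j has 2j+1 vertices, so p^{2j}_{k,i} = 0 for i > 2j+1.
motzkinFormula : (k r n : ℕ) → ℕ
motzkinFormula k r n =
  sumUpTo (n / 2) λ j →
    sumUpTo (2 * j + 1) λ i →
      pedCount j k i * multiBinom (n ∸ 2 * j) i * r ^ (n ∸ 2 * j)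
  where open import Data.Nat.DivMod using (_/_)

module Submission where

-- Let m_h(n) be the number of coloured k-Motzkin paths of length n starting
-- at height h, and put c_h = r if h = k and c_h = 0 otherwise (the number of
-- flat steps available at height h).  Splitting off the first step gives
--   m_h(n+1) = m_{h+1}(n) + [h > 0] m_{h-1}(n) + c_h m_h(n),   m_h(0) = [h = 0],
-- and this recurrence determines m completely.  On the Dyck side let
-- s_h(m,a) = Σ_w multiBinom a (#vertices of w at level k) r^a, summed over Dyck
-- paths w of length m from height h (a flat steps distributed over the
-- level-k vertices).  Pascal's rule for multiBinom turns the first-step
-- decomposition of w into a two-dimensional recurrence for s_h, and summing it
-- along the antidiagonals m + a = n shows that the convolution
-- Σ_{m+a=n} s_h(m,a) satisfies the same recurrence as m_h(n).  Hence
-- m_0(n) = Σ_{m+a=n} s_0(m,a); dropping odd m (there are no Dyck paths of odd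
-- length) and grouping Dyck paths by their number of level-k vertices gives
-- the formula of the theorem.

open import Defs
open import Data.Nat using (ℕ; _≤_)
open import Relation.Binary.PropositionalEquality using (_≡_)
open import Data.Nat using (zero; suc; _+_; _*_; _∸_; _^_; _≡ᵇ_; z≤n; s≤s)
open import Data.Nat.Properties
  using (+-identityʳ; +-assoc; +-suc; *-suc; *-zeroʳ; *-identityʳ; *-assoc; *-distribˡ-+; *-distribʳ-+;
         +-mono-≤; even≢odd; +-commutativeSemigroup)
open import Algebra.Properties.CommutativeSemigroup +-commutativeSemigroup
  using (interchange; x∙yz≈y∙xz)
open import Data.Nat.Combinatorics using (_C_; nCn≡1; nCk+nC[k+1]≡[n+1]C[k+1])
open import Data.Nat.DivMod using (_/_; m/n≡1+[m∸n]/n)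
open import Data.Nat.ListAction using (sum)
open import Data.Nat.ListAction.Properties using (sum-++)
open import Data.Nat.Tactic.RingSolver using (solve-∀)
open import Data.List using (List; []; _∷_; map; concatMap; upTo; length; allFin)
open import Data.List.Properties using (map-∘; map-++; map-upTo; map-applyUpTo; length-tabulate)
open import Data.List.Relation.Unary.All as All using (All; []; _∷_)
open import Data.List.Relation.Unary.All.Properties using (map⁺; concat⁺)
open import Data.Bool using (Bool; true; false; if_then_else_; _∧_)
open import Data.Product using (∃; _,_)
open import Relation.Binary.PropositionalEquality using (refl; sym; trans; cong; cong₂; subst; module ≡-Reasoning)
open import Relation.Nullary using (contradiction)

open ≡-Reasoning

ind : Bool → ℕ
ind b = if b then 1 else 0

ind-∧ : ∀ b c → ind (b ∧ c) ≡ ind b * ind c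
ind-∧ true  c = sym (+-identityʳ (ind c))
ind-∧ false c = refl

ind≤1 : ∀ b → ind b ≤ 1
ind≤1 true  = s≤s z≤n
ind≤1 false = z≤n

-- shift f i = f (i - 1), extended by 0 at i = 0.  It expresses both "one level
-- lower" (a down step from height 0 is impossible) and "one flat step fewer".
shift : (ℕ → ℕ) → ℕ → ℕ
shift f zero    = 0
shift f (suc i) = f i

shift-cong : ∀ {f g : ℕ → ℕ} → (∀ i → f i ≡ g i) → ∀ i → shift f i ≡ shift g i
shift-cong e zero    = refl
shift-cong e (suc i) = e i

module _ {A : Set} where

  sum-ext : ∀ {f g : A → ℕ} → (∀ x → f x ≡ g x) → ∀ xs → sum (map f xs) ≡ sum (map g xs)
  sum-ext e []       = refl
  sum-ext e (x ∷ xs) = cong₂ _+_ (e x) (sum-ext e xs)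

  sum-ext-All : ∀ {P : A → Set} {f g : A → ℕ} → (∀ x → P x → f x ≡ g x) →
                ∀ {xs} → All P xs → sum (map f xs) ≡ sum (map g xs)
  sum-ext-All e []         = refl
  sum-ext-All e {x ∷ xs} (px ∷ pxs) = cong₂ _+_ (e x px) (sum-ext-All e pxs)

  sum-zero : ∀ (xs : List A) → sum (map (λ _ → 0) xs) ≡ 0
  sum-zero []       = refl
  sum-zero (x ∷ xs) = sum-zero xs

  sum-const : ∀ c (xs : List A) → sum (map (λ _ → c) xs) ≡ length xs * c
  sum-const c []       = refl
  sum-const c (x ∷ xs) = cong (c +_) (sum-const c xs)

  sum-+ : ∀ (f g : A → ℕ) xs → sum (map (λ x → f x + g x) xs) ≡ sum (map f xs) + sum (map g xs)
  sum-+ f g []       = refl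
  sum-+ f g (x ∷ xs) =
    trans (cong (f x + g x +_) (sum-+ f g xs)) (interchange (f x) (g x) _ _)

  sum-*ˡ : ∀ c (f : A → ℕ) xs → sum (map (λ x → c * f x) xs) ≡ c * sum (map f xs)
  sum-*ˡ c f []       = sym (*-zeroʳ c)
  sum-*ˡ c f (x ∷ xs) = trans (cong (c * f x +_) (sum-*ˡ c f xs)) (sym (*-distribˡ-+ c (f x) _))

  sum-*ʳ : ∀ (f : A → ℕ) c xs → sum (map (λ x → f x * c) xs) ≡ sum (map f xs) * c
  sum-*ʳ f c []       = refl
  sum-*ʳ f c (x ∷ xs) = trans (cong (f x * c +_) (sum-*ʳ f c xs)) (sym (*-distribʳ-+ c (f x) _))

  sum-shift : ∀ (F : A → ℕ → ℕ) xs i →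
              sum (map (λ x → shift (F x) i) xs) ≡ shift (λ j → sum (map (λ x → F x j) xs)) i
  sum-shift F xs zero    = sum-zero xs
  sum-shift F xs (suc i) = refl

module _ {A B : Set} where

  sum-swap : ∀ (f : A → B → ℕ) xs ys →
             sum (map (λ x → sum (map (f x) ys)) xs) ≡ sum (map (λ y → sum (map (λ x → f x y) xs)) ys)
  sum-swap f []       ys = sym (sum-zero ys)
  sum-swap f (x ∷ xs) ys =
    trans (cong (sum (map (f x) ys) +_) (sum-swap f xs ys)) (sym (sum-+ (f x) _ ys))

  sum-concatMap : ∀ (f : B → ℕ) (g : A → List B) xs →
                  sum (map f (concatMap g xs)) ≡ sum (map (λ x → sum (map f (g x))) xs)
  sum-concatMap f g []       = refl
  sum-concatMap f g (x ∷ xs) =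
    trans (cong sum (map-++ f (g x) (concatMap g xs)))
          (trans (sum-++ (map f (g x)) _) (cong (sum (map f (g x)) +_) (sum-concatMap f g xs)))

module _ {A : Set} (letters : List A) where

  sum-words-suc : ∀ n (f : List A → ℕ) →
    sum (map f (words letters (suc n))) ≡
    sum (map (λ w → sum (map (λ l → f (l ∷ w)) letters)) (words letters n))
  sum-words-suc n f =
    trans (sum-concatMap f (λ w → map (_∷ w) letters) (words letters n))
          (sum-ext (λ w → cong sum (sym (map-∘ letters))) (words letters n))

  words-length : ∀ n → All (λ w → length w ≡ n) (words letters n)
  words-length zero    = refl ∷ []
  words-length (suc n) =
    concat⁺ (map⁺ (All.map (λ len → map⁺ (All.universal (λ _ → cong suc len) letters))
                           (words-length n)))

sumUpTo-cons : ∀ n (g : ℕ → ℕ) → sumUpTo (suc n) g ≡ g 0 + sumUpTo n (λ i → g (suc i))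
sumUpTo-cons n g =
  cong (g 0 +_) (cong sum (trans (map-applyUpTo suc g (suc n)) (sym (map-upTo (λ i → g (suc i)) (suc n)))))

sumUpTo-delta : ∀ B v (x : ℕ → ℕ) → v ≤ B → sumUpTo B (λ i → ind (v ≡ᵇ i) * x i) ≡ x v
sumUpTo-delta zero    zero    x z≤n       = trans (+-identityʳ _) (+-identityʳ (x 0))
sumUpTo-delta (suc B) zero    x z≤n       =
  trans (sumUpTo-cons B (λ i → ind (0 ≡ᵇ i) * x i))
        (trans (cong (x 0 + 0 +_) (sum-zero (upTo (suc B)))) (trans (+-identityʳ _) (+-identityʳ (x 0))))
sumUpTo-delta (suc B) (suc v) x (s≤s v≤B) =
  trans (sumUpTo-cons B (λ i → ind (suc v ≡ᵇ i) * x i)) (sumUpTo-delta B v (λ i → x (suc i)) v≤B)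

sumUpTo-evens : ∀ (g : ℕ → ℕ) → (∀ j → g (suc (2 * j)) ≡ 0) →
                ∀ n → sumUpTo n g ≡ sumUpTo (n / 2) (λ j → g (2 * j))
sumUpTo-evens g odd zero          = refl
sumUpTo-evens g odd (suc zero)    = cong (λ t → g 0 + (t + 0)) (odd 0)
sumUpTo-evens g odd (suc (suc n)) = begin
  sumUpTo (suc (suc n)) g
    ≡⟨ trans (sumUpTo-cons (suc n) g) (cong (g 0 +_) (sumUpTo-cons n (λ i → g (suc i)))) ⟩
  g 0 + (g 1 + sumUpTo n g₂)
    ≡⟨ cong (λ t → g 0 + (t + sumUpTo n g₂)) (odd 0) ⟩
  g 0 + sumUpTo n g₂
    ≡⟨ cong (g 0 +_) (sumUpTo-evens g₂ odd₂ n) ⟩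
  g 0 + sumUpTo (n / 2) (λ j → g₂ (2 * j))
    ≡⟨ cong (g 0 +_) (sum-ext (λ j → cong g (sym (*-suc 2 j))) (upTo (suc (n / 2)))) ⟩
  g 0 + sumUpTo (n / 2) (λ j → g (2 * suc j))
    ≡⟨ sym (sumUpTo-cons (n / 2) (λ j → g (2 * j))) ⟩
  sumUpTo (suc (n / 2)) (λ j → g (2 * j))
    ≡⟨ cong (λ q → sumUpTo q (λ j → g (2 * j))) (sym (m/n≡1+[m∸n]/n {suc (suc n)} {2} (s≤s (s≤s z≤n)))) ⟩
  sumUpTo (suc (suc n) / 2) (λ j → g (2 * j)) ∎
  where
  g₂ : ℕ → ℕ
  g₂ i = g (suc (suc i))
  odd₂ : ∀ j → g₂ (suc (2 * j)) ≡ 0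
  odd₂ j = trans (cong (λ t → g (suc t)) (sym (*-suc 2 j))) (odd (suc j))

sum-by-fibres : ∀ {A : Set} (p : A → Bool) (v : A → ℕ) (x : ℕ → ℕ) B xs →
  All (λ y → v y ≤ B) xs →
  sumUpTo B (λ i → count (λ y → p y ∧ (v y ≡ᵇ i)) xs * x i) ≡ sum (map (λ y → ind (p y) * x (v y)) xs)
sum-by-fibres p v x B xs bounded = begin
  sumUpTo B (λ i → count (λ y → p y ∧ (v y ≡ᵇ i)) xs * x i)
    ≡⟨ sum-ext (λ i → sym (sum-*ʳ _ (x i) xs)) (upTo (suc B)) ⟩
  sum (map (λ i → sum (map (λ y → ind (p y ∧ (v y ≡ᵇ i)) * x i) xs)) (upTo (suc B)))
    ≡⟨ sum-swap (λ i y → ind (p y ∧ (v y ≡ᵇ i)) * x i) (upTo (suc B)) xs ⟩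
  sum (map (λ y → sumUpTo B (λ i → ind (p y ∧ (v y ≡ᵇ i)) * x i)) xs)
    ≡⟨ sum-ext-All fibre bounded ⟩
  sum (map (λ y → ind (p y) * x (v y)) xs) ∎
  where
  fibre : ∀ y → v y ≤ B → sumUpTo B (λ i → ind (p y ∧ (v y ≡ᵇ i)) * x i) ≡ ind (p y) * x (v y)
  fibre y vy≤B with p y
  ... | true  = trans (sumUpTo-delta B (v y) x vy≤B) (sym (+-identityʳ _))
  ... | false = sum-zero (upTo (suc B))

-- Antidiagonal convolution: conv f n = Σ_{m + a = n} f m a

conv : (ℕ → ℕ → ℕ) → ℕ → ℕ
conv f zero    = f 0 0
conv f (suc n) = f 0 (suc n) + conv (λ m a → f (suc m) a) n

conv-ext : ∀ {f g : ℕ → ℕ → ℕ} → (∀ m a → f m a ≡ g m a) → ∀ n → conv f n ≡ conv g n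
conv-ext e zero    = e 0 0
conv-ext e (suc n) = cong₂ _+_ (e 0 (suc n)) (conv-ext (λ m → e (suc m)) n)

conv-zero : ∀ n → conv (λ _ _ → 0) n ≡ 0
conv-zero zero    = refl
conv-zero (suc n) = conv-zero n

conv-+ : ∀ (f g : ℕ → ℕ → ℕ) n → conv (λ m a → f m a + g m a) n ≡ conv f n + conv g n
conv-+ f g zero    = refl
conv-+ f g (suc n) =
  trans (cong (f 0 (suc n) + g 0 (suc n) +_) (conv-+ (λ m → f (suc m)) (λ m → g (suc m)) n))
        (interchange (f 0 (suc n)) (g 0 (suc n)) _ _)

conv-* : ∀ c (f : ℕ → ℕ → ℕ) n → conv (λ m a → c * f m a) n ≡ c * conv f n
conv-* c f zero    = refl
conv-* c f (suc n) =
  trans (cong (c * f 0 (suc n) +_) (conv-* c (λ m → f (suc m)) n)) (sym (*-distribˡ-+ c (f 0 (suc n)) _))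

conv-shift-outer : ∀ (F : ℕ → ℕ → ℕ → ℕ) h n →
  conv (λ m a → shift (λ h′ → F h′ m a) h) n ≡ shift (λ h′ → conv (F h′) n) h
conv-shift-outer F zero    n = conv-zero n
conv-shift-outer F (suc h) n = refl

conv-snoc : ∀ (f : ℕ → ℕ → ℕ) n → conv f (suc n) ≡ conv (λ m a → f m (suc a)) n + f (suc n) 0
conv-snoc f zero    = refl
conv-snoc f (suc n) =
  trans (cong (f 0 (suc (suc n)) +_) (conv-snoc (λ m → f (suc m)) n)) (sym (+-assoc (f 0 (suc (suc n))) _ _))

-- If F(m,a) = G(m-1,a) + H(m,a-1) at every (m,a) ≠ (0,0) (terms with a
-- negative index omitted), the antidiagonal sums satisfy F_{n+1} = G_n + H_n.
conv-recurrence : ∀ (F G H : ℕ → ℕ → ℕ) →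
  (∀ m a → F (suc m) a ≡ G m a + shift (H (suc m)) a) →
  (∀ a → F 0 (suc a) ≡ H 0 a) →
  ∀ n → conv F (suc n) ≡ conv G n + conv H n
conv-recurrence F G H step empty n = begin
  conv F (suc n)
    ≡⟨ cong₂ _+_ (empty n) (conv-ext step n) ⟩
  H 0 n + conv (λ m a → G m a + shift (H (suc m)) a) n
    ≡⟨ cong (H 0 n +_) (conv-+ G _ n) ⟩
  H 0 n + (conv G n + conv (λ m → shift (H (suc m))) n)
    ≡⟨ x∙yz≈y∙xz (H 0 n) (conv G n) _ ⟩
  conv G n + conv (λ m → shift (H m)) (suc n)
    ≡⟨ cong (conv G n +_) (trans (conv-snoc (λ m → shift (H m)) n) (+-identityʳ _)) ⟩
  conv G n + conv H n ∎

conv-as-sum : ∀ (f : ℕ → ℕ → ℕ) n → conv f n ≡ sumUpTo n (λ m → f m (n ∸ m))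
conv-as-sum f zero    = sym (+-identityʳ (f 0 0))
conv-as-sum f (suc n) =
  trans (cong (f 0 (suc n) +_) (conv-as-sum (λ m → f (suc m)) n)) (sym (sumUpTo-cons n (λ m → f m (suc n ∸ m))))

-- multiBinom a i = binom(a+i-1, a): ways to put a flat steps on i vertices

multiBinom-zero : ∀ i → multiBinom 0 i ≡ 1
multiBinom-zero zero    = refl
multiBinom-zero (suc i) = refl

multiBinom-suc : ∀ a i → multiBinom a (suc i) ≡ (a + i) C a
multiBinom-suc zero    i = refl
multiBinom-suc (suc a) i = refl

-- Pascal's rule: either the first vertex carries no flat step, or it carries
-- at least one and we remove one of them
multiBinom-pascal : ∀ a v → multiBinom (suc a) (suc v) ≡ multiBinom a (suc v) + multiBinom (suc a) v
multiBinom-pascal a zero    =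
  trans (diagonal (suc a)) (sym (trans (+-identityʳ _) (trans (multiBinom-suc a 0) (diagonal a))))
  where
  diagonal : ∀ n → (n + 0) C n ≡ 1
  diagonal n = trans (cong (_C n) (+-identityʳ n)) (nCn≡1 n)
multiBinom-pascal a (suc i) = begin
  suc (a + suc i) C suc a
    ≡⟨ sym (nCk+nC[k+1]≡[n+1]C[k+1] (a + suc i) a) ⟩
  (a + suc i) C a + (a + suc i) C suc a
    ≡⟨ cong₂ _+_ (sym (multiBinom-suc a (suc i))) (cong (_C suc a) (+-suc a i)) ⟩
  multiBinom a (suc (suc i)) + suc (a + i) C suc a ∎

dyck-even : ∀ h w → isDyckFrom h w ≡ true → ∃ λ q → h + length w ≡ 2 * q
dyck-even zero    []      _ = 0 , refl
dyck-even (suc h) []      ()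
dyck-even h       (U ∷ w) d with dyck-even (suc h) w d
... | q , eq = q , trans (+-suc h (length w)) eq
dyck-even zero    (D ∷ w) ()
dyck-even (suc h) (D ∷ w) d with dyck-even h w d
... | q , eq = suc q , trans (cong suc (+-suc h (length w)))
                             (trans (cong (λ t → suc (suc t)) eq) (sym (*-suc 2 q)))

vertices-bound : ∀ k h w → verticesAtFrom k h w ≤ length w + 1
vertices-bound k h []      = +-mono-≤ (ind≤1 (h ≡ᵇ k)) z≤n
vertices-bound k h (U ∷ w) = +-mono-≤ (ind≤1 (h ≡ᵇ k)) (vertices-bound k (suc h) w)
vertices-bound k h (D ∷ w) = +-mono-≤ (ind≤1 (h ≡ᵇ k)) (vertices-bound k (h ∸ 1) w)

module Counting (k r : ℕ) where

  flatsAt : ℕ → ℕ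
  flatsAt h = r * ind (h ≡ᵇ k)

  MotzkinRecurrence : (ℕ → ℕ → ℕ) → Set
  MotzkinRecurrence X =
    ∀ h n → X h (suc n) ≡ X (suc h) n + shift (λ h′ → X h′ n) h + flatsAt h * X h n

  recurrence-unique : ∀ (X Y : ℕ → ℕ → ℕ) → (∀ h → X h 0 ≡ Y h 0) →
    MotzkinRecurrence X → MotzkinRecurrence Y → ∀ n h → X h n ≡ Y h n
  recurrence-unique X Y init recX recY zero    h = init h
  recurrence-unique X Y init recX recY (suc n) h =
    trans (recX h n)
      (trans (cong₂ _+_ (cong₂ _+_ (same (suc h)) (shift-cong same h)) (cong (flatsAt h *_) (same h)))
             (sym (recY h n)))
    where
    same : ∀ h′ → X h′ n ≡ Y h′ n
    same = recurrence-unique X Y init recX recY n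

  motzkinFrom : ℕ → ℕ → ℕ
  motzkinFrom h n = count (isKMotzkinFrom k h) (words (cSteps r) n)

  isMotzkin : ℕ → List (CStep r) → ℕ
  isMotzkin h w = ind (isKMotzkinFrom k h w)

  motzkin-first-step : ∀ h w →
    sum (map (λ l → isMotzkin h (l ∷ w)) (cSteps r)) ≡
    isMotzkin (suc h) w + shift (λ h′ → isMotzkin h′ w) h + flatsAt h * isMotzkin h w
  motzkin-first-step h w =
    trans (cong₂ (λ d f → isMotzkin (suc h) w + (d + f)) (down-step h) flats)
          (sym (+-assoc (isMotzkin (suc h) w) _ _))
    where
    down-step : ∀ h → isMotzkin h (down ∷ w) ≡ shift (λ h′ → isMotzkin h′ w) h
    down-step zero    = refl
    down-step (suc h) = refl
    flats : sum (map (λ l → isMotzkin h (l ∷ w)) (map flat (allFin r))) ≡ flatsAt h * isMotzkin h w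
    flats = begin
      sum (map (λ l → isMotzkin h (l ∷ w)) (map flat (allFin r)))
        ≡⟨ cong sum (sym (map-∘ (allFin r))) ⟩
      sum (map (λ _ → ind ((h ≡ᵇ k) ∧ isKMotzkinFrom k h w)) (allFin r))
        ≡⟨ sum-const _ (allFin r) ⟩
      length (allFin r) * ind ((h ≡ᵇ k) ∧ isKMotzkinFrom k h w)
        ≡⟨ cong₂ _*_ (length-tabulate {n = r} (λ c → c)) (ind-∧ (h ≡ᵇ k) _) ⟩
      r * (ind (h ≡ᵇ k) * isMotzkin h w)
        ≡⟨ sym (*-assoc r _ _) ⟩
      flatsAt h * isMotzkin h w ∎

  motzkin-recurrence : MotzkinRecurrence motzkinFrom
  motzkin-recurrence h n = begin
    motzkinFrom h (suc n)
      ≡⟨ sum-words-suc (cSteps r) n (isMotzkin h) ⟩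
    sum (map (λ w → sum (map (λ l → isMotzkin h (l ∷ w)) (cSteps r))) W)
      ≡⟨ sum-ext (motzkin-first-step h) W ⟩
    sum (map (λ w → isMotzkin (suc h) w + shift (λ h′ → isMotzkin h′ w) h + flatsAt h * isMotzkin h w) W)
      ≡⟨ sum-+ _ _ W ⟩
    sum (map (λ w → isMotzkin (suc h) w + shift (λ h′ → isMotzkin h′ w) h) W) +
    sum (map (λ w → flatsAt h * isMotzkin h w) W)
      ≡⟨ cong₂ _+_ (trans (sum-+ _ _ W) (cong (motzkinFrom (suc h) n +_) (sum-shift _ W h)))
                   (sum-*ˡ (flatsAt h) _ W) ⟩
    motzkinFrom (suc h) n + shift (λ h′ → motzkinFrom h′ n) h + flatsAt h * motzkinFrom h n ∎
    where
    W = words (cSteps r) n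

  weight : ℕ → ℕ → ℕ
  weight a v = multiBinom a v * r ^ a

  weight-zero : ∀ v → weight 0 v ≡ 1
  weight-zero v = cong (_* 1) (multiBinom-zero v)

  -- Adding a vertex at level k (b = true): either it carries no flat step, or
  -- one of its flats (r colours) is removed.  Scaled by an arbitrary factor d.
  weight-enter : ∀ d b v a →
    d * weight a (ind b + v) ≡ d * weight a v + shift (λ a′ → r * ind b * (d * weight a′ (ind b + v))) a
  weight-enter d b     v zero    =
    trans (cong (d *_) (trans (weight-zero (ind b + v)) (sym (weight-zero v)))) (sym (+-identityʳ _))
  weight-enter d false v (suc a) =
    sym (trans (cong (λ c → d * weight (suc a) v + c * (d * weight a v)) (*-zeroʳ r)) (+-identityʳ _))
  weight-enter d true  v (suc a) = begin
    d * (multiBinom (suc a) (suc v) * (r * r ^ a))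
      ≡⟨ cong (λ t → d * (t * (r * r ^ a))) (multiBinom-pascal a v) ⟩
    d * ((multiBinom a (suc v) + multiBinom (suc a) v) * (r * r ^ a))
      ≡⟨ regroup d (multiBinom a (suc v)) (multiBinom (suc a) v) r (r ^ a) ⟩
    d * (multiBinom (suc a) v * (r * r ^ a)) + r * 1 * (d * (multiBinom a (suc v) * r ^ a)) ∎
    where
    regroup : ∀ d p q r R → d * ((p + q) * (r * R)) ≡ d * (q * (r * R)) + r * 1 * (d * (p * R))
    regroup = solve-∀

  dyckWeight : ℕ → List DStep → ℕ → ℕ
  dyckWeight h w a = ind (isDyckFrom h w) * weight a (verticesAtFrom k h w)

  afterStep : ℕ → DStep → List DStep → ℕ → ℕ
  afterStep h U w a = dyckWeight (suc h) w a
  afterStep h D w a = shift (λ h′ → dyckWeight h′ w a) h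

  -- the first step adds the start vertex to those counted by the rest of the path
  dyck-step : ∀ h x w a →
    dyckWeight h (x ∷ w) a ≡ afterStep h x w a + shift (λ a′ → flatsAt h * dyckWeight h (x ∷ w) a′) a
  dyck-step h       U w = weight-enter (ind (isDyckFrom (suc h) w)) (h ≡ᵇ k) (verticesAtFrom k (suc h) w)
  dyck-step zero    D w = weight-enter 0 (zero ≡ᵇ k) 0
  dyck-step (suc h) D w = weight-enter (ind (isDyckFrom h w)) (suc h ≡ᵇ k) (verticesAtFrom k h w)

  dyck-first-step : ∀ h w a →
    sum (map (λ x → dyckWeight h (x ∷ w) a) dSteps) ≡
    dyckWeight (suc h) w a + shift (λ h′ → dyckWeight h′ w a) h +
    shift (λ a′ → flatsAt h * sum (map (λ x → dyckWeight h (x ∷ w) a′) dSteps)) a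
  dyck-first-step h w a =
    trans (sum-ext (λ x → dyck-step h x w a) dSteps)
      (trans (sum-+ (λ x → afterStep h x w a) (λ x → shift (λ a′ → flatsAt h * dyckWeight h (x ∷ w) a′) a) dSteps)
             (cong₂ _+_ (cong (dyckWeight (suc h) w a +_) (+-identityʳ _))
                        (trans (sum-shift (λ x a′ → flatsAt h * dyckWeight h (x ∷ w) a′) dSteps a)
                               (shift-cong (λ a′ → sum-*ˡ (flatsAt h) (λ x → dyckWeight h (x ∷ w) a′) dSteps) a))))

  dyckSum : ℕ → ℕ → ℕ → ℕ
  dyckSum h m a = sum (map (λ w → dyckWeight h w a) (words dSteps m))

  dyckSum-step : ∀ h m a →
    dyckSum h (suc m) a ≡
    dyckSum (suc h) m a + shift (λ h′ → dyckSum h′ m a) h + shift (λ a′ → flatsAt h * dyckSum h (suc m) a′) a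
  dyckSum-step h m a = begin
    dyckSum h (suc m) a
      ≡⟨ sum-words-suc dSteps m (λ w → dyckWeight h w a) ⟩
    sum (map (λ w → sum (map (λ x → dyckWeight h (x ∷ w) a) dSteps)) W)
      ≡⟨ sum-ext (λ w → dyck-first-step h w a) W ⟩
    sum (map (λ w → dyckWeight (suc h) w a + shift (λ h′ → dyckWeight h′ w a) h + later w a) W)
      ≡⟨ sum-+ _ _ W ⟩
    sum (map (λ w → dyckWeight (suc h) w a + shift (λ h′ → dyckWeight h′ w a) h) W) + sum (map (λ w → later w a) W)
      ≡⟨ cong₂ _+_ (trans (sum-+ _ _ W) (cong (dyckSum (suc h) m a +_) (sum-shift _ W h)))
                   (trans (sum-shift _ W a) (shift-cong regroup a)) ⟩
    dyckSum (suc h) m a + shift (λ h′ → dyckSum h′ m a) h + shift (λ a′ → flatsAt h * dyckSum h (suc m) a′) a ∎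
    where
    W = words dSteps m
    later : List DStep → ℕ → ℕ
    later w = shift (λ a′ → flatsAt h * sum (map (λ x → dyckWeight h (x ∷ w) a′) dSteps))
    regroup : ∀ a′ → sum (map (λ w → flatsAt h * sum (map (λ x → dyckWeight h (x ∷ w) a′) dSteps)) W) ≡
                     flatsAt h * dyckSum h (suc m) a′
    regroup a′ = trans (sum-*ˡ (flatsAt h) _ W) (cong (flatsAt h *_) (sym (sum-words-suc dSteps m _)))

  -- the empty path: all flat steps sit on its single vertex
  dyckSum-empty : ∀ h a → dyckSum h 0 (suc a) ≡ flatsAt h * dyckSum h 0 a
  dyckSum-empty h a = begin
    d * weight (suc a) (ind b + 0) + 0
      ≡⟨ +-identityʳ _ ⟩
    d * weight (suc a) (ind b + 0)
      ≡⟨ weight-enter d b 0 (suc a) ⟩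
    d * weight (suc a) 0 + flatsAt h * (d * weight a (ind b + 0))
      ≡⟨ cong₂ _+_ (*-zeroʳ d) (cong (flatsAt h *_) (sym (+-identityʳ _))) ⟩
    flatsAt h * (d * weight a (ind b + 0) + 0) ∎
    where
    d = ind (h ≡ᵇ 0)
    b = h ≡ᵇ k

  dyckConv : ℕ → ℕ → ℕ
  dyckConv h n = conv (dyckSum h) n

  dyckConv-recurrence : MotzkinRecurrence dyckConv
  dyckConv-recurrence h n = begin
    conv (dyckSum h) (suc n)
      ≡⟨ conv-recurrence (dyckSum h) _ (λ m a → flatsAt h * dyckSum h m a) (dyckSum-step h) (dyckSum-empty h) n ⟩
    conv (λ m a → dyckSum (suc h) m a + shift (λ h′ → dyckSum h′ m a) h) n + conv (λ m a → flatsAt h * dyckSum h m a) n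
      ≡⟨ cong₂ _+_ (trans (conv-+ (dyckSum (suc h)) _ n) (cong (dyckConv (suc h) n +_) (conv-shift-outer dyckSum h n)))
                   (conv-* (flatsAt h) (dyckSum h) n) ⟩
    dyckConv (suc h) n + shift (λ h′ → dyckConv h′ n) h + flatsAt h * dyckConv h n ∎

  -- both families satisfy the recurrence with initial values [h = 0]
  motzkin≡dyckConv : ∀ n h → motzkinFrom h n ≡ dyckConv h n
  motzkin≡dyckConv = recurrence-unique motzkinFrom dyckConv initial motzkin-recurrence dyckConv-recurrence
    where
    initial : ∀ h → motzkinFrom h 0 ≡ dyckConv h 0
    initial h =
      cong (_+ 0) (sym (trans (cong (ind (h ≡ᵇ 0) *_) (weight-zero (verticesAtFrom k h []))) (*-identityʳ _)))

  -- there are no Dyck paths of odd length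
  dyckSum-odd : ∀ j a → dyckSum 0 (suc (2 * j)) a ≡ 0
  dyckSum-odd j a =
    trans (sum-ext-All {g = λ _ → 0} vanish (words-length dSteps (suc (2 * j)))) (sum-zero (words dSteps (suc (2 * j))))
    where
    vanish : ∀ w → length w ≡ suc (2 * j) → dyckWeight 0 w a ≡ 0
    vanish w len with isDyckFrom 0 w in dyck
    ... | false = refl
    ... | true  with dyck-even 0 w dyck
    ...   | q , even = contradiction (trans (sym even) len) (even≢odd q j)

  dyckSum-by-ped : ∀ j a →
    dyckSum 0 (2 * j) a ≡ sumUpTo (2 * j + 1) (λ i → pedCount j k i * multiBinom a i * r ^ a)
  dyckSum-by-ped j a =
    sym (trans (sum-ext (λ i → *-assoc (pedCount j k i) _ _) (upTo (suc (2 * j + 1))))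
               (sum-by-fibres isDyck (verticesAt k) (weight a) (2 * j + 1) (words dSteps (2 * j)) bounded))
    where
    bounded : All (λ w → verticesAt k w ≤ 2 * j + 1) (words dSteps (2 * j))
    bounded = All.map (λ {w} len → subst (λ l → verticesAt k w ≤ l + 1) len (vertices-bound k 0 w))
                      (words-length dSteps (2 * j))

mainTheorem4 : (k r n : ℕ) → 1 ≤ r → motzkinCount k r n ≡ motzkinFormula k r n
mainTheorem4 k r n _ = begin
  motzkinCount k r n
    ≡⟨ motzkin≡dyckConv n 0 ⟩
  conv (dyckSum 0) n
    ≡⟨ conv-as-sum (dyckSum 0) n ⟩
  sumUpTo n (λ m → dyckSum 0 m (n ∸ m))
    ≡⟨ sumUpTo-evens _ (λ j → dyckSum-odd j (n ∸ suc (2 * j))) n ⟩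
  sumUpTo (n / 2) (λ j → dyckSum 0 (2 * j) (n ∸ 2 * j))
    ≡⟨ sum-ext (λ j → dyckSum-by-ped j (n ∸ 2 * j)) (upTo (suc (n / 2))) ⟩
  motzkinFormula k r n ∎
  where
  open Counting k r
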